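{- For every integer $n\geq 1$, $M_{\mathbf{c}}(n)=\sum_{i=0}^{n-1}c_{i}$ and $m_{\mathbf{c}}(n)=0$.
   Context: The Cantor sequence $\mathbf{c}=c_0c_1c_2\cdots\in\{0,1\}^{\mathbb N}$ is defined by $c_0=1$ and $c_{3n}=c_{3n+2}=c_n$, $c_{3n+1}=0$ for all $n\geq 0$. For $n\ge1$, $M_{\mathbf c}(n)=\max\{\sum_{j=i}^{i+n-1}c_j\mid i\geq0\}$ and $m_{\mathbf c}(n)=\min\{\sum_{j=i}^{i+n-1}c_j\mid i\geq0\}$. -}

module Defs where

open import Data.Nat using (ℕ; zero; suc; _+_; _≤_)
open import Data.Nat.DivMod using (_/_; _%_)
open import Data.Product using (_×_; ∃)
open import Relation.Binary.PropositionalEquality using (_≡_)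

-- Cantor sequence, by the recursion c_0 = 1, c_{3n} = c_{3n+2} = c_n, c_{3n+1} = 0.
-- Written with a fuel argument (fuel > k always suffices, since k / 3 < k for k > 0).
cantorAux : ℕ → ℕ → ℕ
cantorAux zero    k = 1
cantorAux (suc f) zero = 1
cantorAux (suc f) (suc k) with suc k % 3
... | 1 = 0
... | _ = cantorAux f (suc k / 3)

cantor : ℕ → ℕ
cantor k = cantorAux (suc k) k

windowSum : ℕ → ℕ → ℕ
windowSum i zero    = 0
windowSum i (suc n) = cantor i + windowSum (suc i) n

prefixSum : ℕ → ℕ
prefixSum n = windowSum 0 n

IsMaxWindow : ℕ → ℕ → Set
IsMaxWindow n v = (∃ λ i → windowSum i n ≡ v) × (∀ i → windowSum i n ≤ v)

IsMinWindow : ℕ → ℕ → Set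
IsMinWindow n v = (∃ λ i → windowSum i n ≡ v) × (∀ i → v ≤ windowSum i n)

module Submission where

-- Write P = prefixSum and W = windowSum.  Since
-- P (i + n) = P i + W i n, the bound  W i n ≤ P n  for every window is the
-- same as the SUBADDITIVITY of prefix sums,  P (a + b) ≤ P a + P b.
--
-- The Cantor sequence is self-similar: for j < 3^K one has
-- c (m·3^K + j) = c m · c j.  With t = 3^K and c 1 = 0, c 2 = 1 this says
-- that on [0, 3t) the sequence is  u 0^t u  with u = c[0, t).  Hence P is
-- constant on [t, 2t] and P x = P t + P (x - 2t) on [2t, 3t].  A purely
-- arithmetical lemma (module `SubadditiveTriple`) shows that these two facts
-- lift subadditivity of any monotone function from sums ≤ t to sums ≤ 3t;
-- induction on K then gives subadditivity of P everywhere.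
--
-- The minimum is 0 because the window of length n ≤ 3^n starting at 3^n
-- lies in a block of zeros; the maximum is attained by the prefix itself.

open import Defs
open import Data.Nat
open import Data.Nat.Properties
open import Data.Nat.DivMod
open import Data.Nat.Divisibility using (n∣m*n)
open import Algebra.Properties.CommutativeSemigroup +-commutativeSemigroup using (x∙yz≈y∙xz)
open import Data.Product using (_×_; _,_)
open import Data.Empty using (⊥-elim)
open import Relation.Nullary using (¬_; yes; no)
open import Relation.Binary.PropositionalEquality

index/3<index : ∀ k → suc k / 3 < suc k
index/3<index k = m/n<m (suc k) 3 (s≤s (s≤s z≤n))

cantorAux-fuel : ∀ f g k → k < f → k < g → cantorAux f k ≡ cantorAux g k
cantorAux-fuel (suc f) (suc g) zero    _ _ = refl
cantorAux-fuel (suc f) (suc g) (suc k) (s≤s k<f) (s≤s k<g) with suc k % 3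
... | 1           = refl
... | 0           = cantorAux-fuel f g (suc k / 3) (≤-trans (index/3<index k) k<f) (≤-trans (index/3<index k) k<g)
... | suc (suc _) = cantorAux-fuel f g (suc k / 3) (≤-trans (index/3<index k) k<f) (≤-trans (index/3<index k) k<g)

cantor-1mod3 : ∀ j → j % 3 ≡ 1 → cantor j ≡ 0
cantor-1mod3 (suc k) j%3≡1 with suc k % 3
cantor-1mod3 (suc k) refl | .1 = refl

cantor-div3 : ∀ j → ¬ (j % 3 ≡ 1) → cantor j ≡ cantor (j / 3)
cantor-div3 zero    _       = refl
cantor-div3 (suc k) j%3≢1 = trans unfold
  (cantorAux-fuel (suc k) (suc (suc k / 3)) (suc k / 3) (index/3<index k) ≤-refl)
  where
  unfold : cantor (suc k) ≡ cantorAux (suc k) (suc k / 3)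
  unfold with suc k % 3
  ... | 0           = refl
  ... | 1           = ⊥-elim (j%3≢1 refl)
  ... | suc (suc _) = refl

cantor-digit-1 : ∀ s j → j % 3 ≡ 1 → cantor (s * 3 + j) ≡ 0
cantor-digit-1 s j j%3≡1 =
  cantor-1mod3 (s * 3 + j) (trans (%-remove-+ˡ j (n∣m*n s)) j%3≡1)

cantor-digit-02 : ∀ s j → ¬ (j % 3 ≡ 1) → cantor (s * 3 + j) ≡ cantor (s + j / 3)
cantor-digit-02 s j j%3≢1 = begin
  cantor (s * 3 + j)           ≡⟨ cantor-div3 (s * 3 + j) (λ e → j%3≢1 (trans (sym (%-remove-+ˡ j (n∣m*n s))) e)) ⟩
  cantor ((s * 3 + j) / 3)     ≡⟨ cong cantor (+-distrib-/-∣ˡ j (n∣m*n s)) ⟩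
  cantor (s * 3 / 3 + j / 3)   ≡⟨ cong (λ x → cantor (x + j / 3)) (m*n/n≡m s 3) ⟩
  cantor (s + j / 3)           ∎
  where open ≡-Reasoning

scale-by-3 : ∀ m K → m * 3 ^ suc K ≡ m * 3 ^ K * 3
scale-by-3 m K = trans (cong (m *_) (*-comm 3 (3 ^ K))) (sym (*-assoc m (3 ^ K) 3))

cantor-self-similar : ∀ K m j → j < 3 ^ K → cantor (m * 3 ^ K + j) ≡ cantor m * cantor j
cantor-self-similar zero m zero _ = begin
  cantor (m * 1 + 0)   ≡⟨ cong cantor (trans (+-identityʳ (m * 1)) (*-identityʳ m)) ⟩
  cantor m             ≡⟨ sym (*-identityʳ (cantor m)) ⟩
  cantor m * 1         ∎
  where open ≡-Reasoning
cantor-self-similar zero m (suc j) (s≤s ())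
cantor-self-similar (suc K) m j j<3t with j % 3 ≟ 1
... | yes j%3≡1 = begin
  cantor (m * 3 ^ suc K + j)   ≡⟨ cong (λ x → cantor (x + j)) (scale-by-3 m K) ⟩
  cantor (s * 3 + j)           ≡⟨ cantor-digit-1 s j j%3≡1 ⟩
  0                            ≡⟨ sym (*-zeroʳ (cantor m)) ⟩
  cantor m * 0                 ≡⟨ cong (cantor m *_) (sym (cantor-1mod3 j j%3≡1)) ⟩
  cantor m * cantor j          ∎
  where
  open ≡-Reasoning
  s : ℕ
  s = m * 3 ^ K
... | no j%3≢1 = begin
  cantor (m * 3 ^ suc K + j)   ≡⟨ cong (λ x → cantor (x + j)) (scale-by-3 m K) ⟩
  cantor (s * 3 + j)           ≡⟨ cantor-digit-02 s j j%3≢1 ⟩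
  cantor (s + j / 3)           ≡⟨ cantor-self-similar K m (j / 3) (m<n*o⇒m/o<n (subst (j <_) (*-comm 3 (3 ^ K)) j<3t)) ⟩
  cantor m * cantor (j / 3)    ≡⟨ cong (cantor m *_) (sym (cantor-div3 j j%3≢1)) ⟩
  cantor m * cantor j          ∎
  where
  open ≡-Reasoning
  s : ℕ
  s = m * 3 ^ K

windowSum-split : ∀ i a b → windowSum i (a + b) ≡ windowSum i a + windowSum (i + a) b
windowSum-split i zero    b = cong (λ x → windowSum x b) (sym (+-identityʳ i))
windowSum-split i (suc a) b = begin
  cantor i + windowSum (suc i) (a + b)
    ≡⟨ cong (cantor i +_) (windowSum-split (suc i) a b) ⟩
  cantor i + (windowSum (suc i) a + windowSum (suc i + a) b)
    ≡⟨ sym (+-assoc (cantor i) _ _) ⟩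
  cantor i + windowSum (suc i) a + windowSum (suc i + a) b
    ≡⟨ cong (λ x → cantor i + windowSum (suc i) a + windowSum x b) (sym (+-suc i a)) ⟩
  cantor i + windowSum (suc i) a + windowSum (i + suc a) b ∎
  where open ≡-Reasoning

prefixSum-split : ∀ i n → prefixSum (i + n) ≡ prefixSum i + windowSum i n
prefixSum-split = windowSum-split 0

prefixSum-mono : ∀ {a b} → a ≤ b → prefixSum a ≤ prefixSum b
prefixSum-mono {a} {b} a≤b = begin
  prefixSum a                             ≤⟨ m≤m+n (prefixSum a) _ ⟩
  prefixSum a + windowSum a (b ∸ a)       ≡⟨ sym (prefixSum-split a (b ∸ a)) ⟩
  prefixSum (a + (b ∸ a))                 ≡⟨ cong prefixSum (m+[n∸m]≡n a≤b) ⟩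
  prefixSum b                             ∎
  where open ≤-Reasoning

windowSum-scaled : ∀ K m j n → j + n ≤ 3 ^ K →
                   windowSum (m * 3 ^ K + j) n ≡ cantor m * windowSum j n
windowSum-scaled K m j zero    _ = sym (*-zeroʳ (cantor m))
windowSum-scaled K m j (suc n) j+n≤t = begin
  cantor (m * 3 ^ K + j) + windowSum (suc (m * 3 ^ K + j)) n
    ≡⟨ cong₂ _+_ (cantor-self-similar K m j (≤-trans (s≤s (m≤m+n j n)) j+1+n≤t))
                 (cong (λ x → windowSum x n) (sym (+-suc (m * 3 ^ K) j))) ⟩
  cantor m * cantor j + windowSum (m * 3 ^ K + suc j) n
    ≡⟨ cong (cantor m * cantor j +_) (windowSum-scaled K m (suc j) n j+1+n≤t) ⟩
  cantor m * cantor j + cantor m * windowSum (suc j) n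
    ≡⟨ sym (*-distribˡ-+ (cantor m) (cantor j) _) ⟩
  cantor m * (cantor j + windowSum (suc j) n) ∎
  where
  open ≡-Reasoning
  j+1+n≤t : suc j + n ≤ 3 ^ K
  j+1+n≤t = subst (_≤ 3 ^ K) (+-suc j n) j+n≤t

-- The middle third [3^K, 2·3^K) consists of zeros  (c 1 = 0).
windowSum-middle : ∀ K n → n ≤ 3 ^ K → windowSum (3 ^ K) n ≡ 0
windowSum-middle K n n≤t = begin
  windowSum (3 ^ K) n           ≡⟨ cong (λ x → windowSum x n) (sym one-block) ⟩
  windowSum (1 * 3 ^ K + 0) n   ≡⟨ windowSum-scaled K 1 0 n n≤t ⟩
  0                             ∎
  where
  open ≡-Reasoning
  one-block : 1 * 3 ^ K + 0 ≡ 3 ^ K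
  one-block = trans (+-identityʳ (1 * 3 ^ K)) (*-identityˡ (3 ^ K))

-- The last third [2·3^K, 3^(K+1)) repeats the first one  (c 2 = 1).
windowSum-last : ∀ K n → n ≤ 3 ^ K → windowSum (2 * 3 ^ K) n ≡ prefixSum n
windowSum-last K n n≤t = begin
  windowSum (2 * 3 ^ K) n       ≡⟨ cong (λ x → windowSum x n) (sym (+-identityʳ (2 * 3 ^ K))) ⟩
  windowSum (2 * 3 ^ K + 0) n   ≡⟨ windowSum-scaled K 2 0 n n≤t ⟩
  1 * prefixSum n               ≡⟨ *-identityˡ (prefixSum n) ⟩
  prefixSum n                   ∎
  where open ≡-Reasoning

double : ∀ t → 2 * t ≡ t + t
double t = cong (t +_) (+-identityʳ t)

triple : ∀ t → 3 * t ≡ 2 * t + t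
triple t = trans (*-distribʳ-+ t 2 1) (cong (2 * t +_) (*-identityˡ t))

prefixSum-flat : ∀ K x → 3 ^ K ≤ x → x ≤ 2 * 3 ^ K → prefixSum x ≡ prefixSum (3 ^ K)
prefixSum-flat K x t≤x x≤2t = begin
  prefixSum x                                   ≡⟨ cong prefixSum (sym (m+[n∸m]≡n t≤x)) ⟩
  prefixSum (3 ^ K + (x ∸ 3 ^ K))               ≡⟨ prefixSum-split (3 ^ K) (x ∸ 3 ^ K) ⟩
  prefixSum (3 ^ K) + windowSum (3 ^ K) (x ∸ 3 ^ K)
    ≡⟨ cong (prefixSum (3 ^ K) +_) (windowSum-middle K (x ∸ 3 ^ K) x-t≤t) ⟩
  prefixSum (3 ^ K) + 0                         ≡⟨ +-identityʳ (prefixSum (3 ^ K)) ⟩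
  prefixSum (3 ^ K)                             ∎
  where
  open ≡-Reasoning
  x-t≤t : x ∸ 3 ^ K ≤ 3 ^ K
  x-t≤t = m≤n+o⇒m∸n≤o x (3 ^ K) (subst (x ≤_) (double (3 ^ K)) x≤2t)

prefixSum-copy : ∀ K x → 2 * 3 ^ K ≤ x → x ≤ 3 * 3 ^ K →
                 prefixSum x ≡ prefixSum (3 ^ K) + prefixSum (x ∸ 2 * 3 ^ K)
prefixSum-copy K x 2t≤x x≤3t = begin
  prefixSum x                                   ≡⟨ cong prefixSum (sym (m+[n∸m]≡n 2t≤x)) ⟩
  prefixSum (2t + d)                            ≡⟨ prefixSum-split 2t d ⟩
  prefixSum 2t + windowSum 2t d                 ≡⟨ cong₂ _+_ P2t≡Pt (windowSum-last K d d≤t) ⟩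
  prefixSum (3 ^ K) + prefixSum d               ∎
  where
  open ≡-Reasoning
  2t d : ℕ
  2t = 2 * 3 ^ K
  d  = x ∸ 2t
  P2t≡Pt : prefixSum 2t ≡ prefixSum (3 ^ K)
  P2t≡Pt = prefixSum-flat K 2t (subst (3 ^ K ≤_) (sym (double (3 ^ K))) (m≤m+n (3 ^ K) (3 ^ K))) ≤-refl
  d≤t : d ≤ 3 ^ K
  d≤t = m≤n+o⇒m∸n≤o x 2t (subst (x ≤_) (triple (3 ^ K)) x≤3t)

module SubadditiveTriple
  (f : ℕ → ℕ) (t : ℕ)
  (mono : ∀ {x y} → x ≤ y → f x ≤ f y)
  (flat : ∀ x → t ≤ x → x ≤ 2 * t → f x ≡ f t)
  (copy : ∀ x → 2 * t ≤ x → x ≤ 3 * t → f x ≡ f t + f (x ∸ 2 * t))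
  (sub  : ∀ a b → a + b ≤ t → f (a + b) ≤ f a + f b)
  where

  open ≤-Reasoning

  -- Both summands in the first third: if a + b > t then f (a + b) = f t,
  -- and t = a + (t - a) with t - a ≤ b.
  both-small : ∀ a b → a ≤ t → b ≤ t → f (a + b) ≤ f a + f b
  both-small a b a≤t b≤t with a + b ≤? t
  ... | yes a+b≤t = sub a b a+b≤t
  ... | no  a+b≰t = begin
    f (a + b)          ≡⟨ flat (a + b) (<⇒≤ t<a+b) (subst (a + b ≤_) (sym (double t)) (+-mono-≤ a≤t b≤t)) ⟩
    f t                ≡⟨ cong f (sym (m+[n∸m]≡n a≤t)) ⟩
    f (a + (t ∸ a))    ≤⟨ sub a (t ∸ a) (≤-reflexive (m+[n∸m]≡n a≤t)) ⟩
    f a + f (t ∸ a)    ≤⟨ +-monoʳ-≤ (f a) (mono (m≤n+o⇒m∸n≤o t a (<⇒≤ t<a+b))) ⟩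
    f a + f b          ∎
    where
    t<a+b : t < a + b
    t<a+b = ≰⇒> a+b≰t

  -- b in the middle third, so f b = f t: the excess of a + b over 2t is
  -- at most a.
  middle : ∀ a b → t ≤ b → b ≤ 2 * t → a + b ≤ 3 * t → f (a + b) ≤ f a + f b
  middle a b t≤b b≤2t a+b≤3t with a + b ≤? 2 * t
  ... | yes a+b≤2t = begin
    f (a + b)          ≡⟨ flat (a + b) (≤-trans t≤b (m≤n+m b a)) a+b≤2t ⟩
    f t                ≡⟨ sym (flat b t≤b b≤2t) ⟩
    f b                ≤⟨ m≤n+m (f b) (f a) ⟩
    f a + f b          ∎
  ... | no a+b≰2t = begin
    f (a + b)                  ≡⟨ copy (a + b) (<⇒≤ (≰⇒> a+b≰2t)) a+b≤3t ⟩
    f t + f (a + b ∸ 2 * t)    ≤⟨ +-monoʳ-≤ (f t) (mono excess≤a) ⟩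
    f t + f a                  ≡⟨ cong (_+ f a) (sym (flat b t≤b b≤2t)) ⟩
    f b + f a                  ≡⟨ +-comm (f b) (f a) ⟩
    f a + f b                  ∎
    where
    excess≤a : a + b ∸ 2 * t ≤ a
    excess≤a = m≤n+o⇒m∸n≤o (a + b) (2 * t) (subst (a + b ≤_) (+-comm a (2 * t)) (+-monoʳ-≤ a b≤2t))

  -- b in the last third: both f b and f (a + b) pick up the same f t, and
  -- the remainders a and b - 2t fit into the first third.
  last : ∀ a b → 2 * t ≤ b → a + b ≤ 3 * t → f (a + b) ≤ f a + f b
  last a b 2t≤b a+b≤3t = begin
    f (a + b)                  ≡⟨ copy (a + b) (≤-trans 2t≤b (m≤n+m b a)) a+b≤3t ⟩
    f t + f (a + b ∸ 2 * t)    ≡⟨ cong (λ x → f t + f x) (+-∸-assoc a 2t≤b) ⟩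
    f t + f (a + e)            ≤⟨ +-monoʳ-≤ (f t) (sub a e a+e≤t) ⟩
    f t + (f a + f e)          ≡⟨ x∙yz≈y∙xz (f t) (f a) (f e) ⟩
    f a + (f t + f e)          ≡⟨ cong (f a +_) (sym (copy b 2t≤b b≤3t)) ⟩
    f a + f b                  ∎
    where
    e : ℕ
    e = b ∸ 2 * t
    a+e≤t : a + e ≤ t
    a+e≤t = subst (_≤ t) (+-∸-assoc a 2t≤b)
              (m≤n+o⇒m∸n≤o (a + b) (2 * t) (subst (a + b ≤_) (triple t) a+b≤3t))
    b≤3t : b ≤ 3 * t
    b≤3t = ≤-trans (m≤n+m b a) a+b≤3t

  one-large : ∀ a b → t ≤ b → a + b ≤ 3 * t → f (a + b) ≤ f a + f b
  one-large a b t≤b a+b≤3t with b ≤? 2 * t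
  ... | yes b≤2t = middle a b t≤b b≤2t a+b≤3t
  ... | no  b≰2t = last a b (<⇒≤ (≰⇒> b≰2t)) a+b≤3t

  subadditive : ∀ a b → a + b ≤ 3 * t → f (a + b) ≤ f a + f b
  subadditive a b a+b≤3t with a ≤? t | b ≤? t
  ... | yes a≤t | yes b≤t = both-small a b a≤t b≤t
  ... | _       | no  b≰t = one-large a b (<⇒≤ (≰⇒> b≰t)) a+b≤3t
  ... | no  a≰t | yes _   = begin
    f (a + b)     ≡⟨ cong f (+-comm a b) ⟩
    f (b + a)     ≤⟨ one-large b a (<⇒≤ (≰⇒> a≰t)) (subst (_≤ 3 * t) (+-comm a b) a+b≤3t) ⟩
    f b + f a     ≡⟨ +-comm (f b) (f a) ⟩
    f a + f b     ∎

prefixSum-subadditive-below : ∀ K a b → a + b ≤ 3 ^ K →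
                              prefixSum (a + b) ≤ prefixSum a + prefixSum b
prefixSum-subadditive-below zero zero    b       _ = ≤-refl
prefixSum-subadditive-below zero (suc a) zero    _ =
  ≤-reflexive (trans (cong prefixSum (+-identityʳ (suc a))) (sym (+-identityʳ (prefixSum (suc a)))))
prefixSum-subadditive-below zero (suc a) (suc b) (s≤s a+1+b≤0) =
  ⊥-elim (n≮0 (subst (_≤ 0) (+-suc a b) a+1+b≤0))
prefixSum-subadditive-below (suc K) =
  SubadditiveTriple.subadditive prefixSum (3 ^ K) prefixSum-mono
    (prefixSum-flat K) (prefixSum-copy K) (prefixSum-subadditive-below K)

n<3^n : ∀ n → n < 3 ^ n
n<3^n zero    = s≤s z≤n
n<3^n (suc n) = begin-strict
  suc n                        ≡⟨ +-comm 1 n ⟩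
  n + 1                        <⟨ +-mono-<-≤ (n<3^n n) (m^n>0 3 n) ⟩
  3 ^ n + 3 ^ n                ≤⟨ +-monoʳ-≤ (3 ^ n) (m≤m+n (3 ^ n) (3 ^ n + 0)) ⟩
  3 ^ suc n                    ∎
  where open ≤-Reasoning

-- Subadditivity without a bound: choose K = a + b.
prefixSum-subadditive : ∀ a b → prefixSum (a + b) ≤ prefixSum a + prefixSum b
prefixSum-subadditive a b = prefixSum-subadditive-below (a + b) a b (<⇒≤ (n<3^n (a + b)))

windowSum≤prefixSum : ∀ i n → windowSum i n ≤ prefixSum n
windowSum≤prefixSum i n = +-cancelˡ-≤ (prefixSum i) (windowSum i n) (prefixSum n)
  (subst (_≤ prefixSum i + prefixSum n) (prefixSum-split i n) (prefixSum-subadditive i n))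

lemma2p2 : ∀ (n : ℕ) → 1 ≤ n → IsMaxWindow n (prefixSum n) × IsMinWindow n 0
lemma2p2 n _ = maximum , minimum
  where
  maximum : IsMaxWindow n (prefixSum n)
  maximum = (0 , refl) , λ i → windowSum≤prefixSum i n
  -- the window starting at 3^n lies in the zero block [3^n, 2·3^n)
  minimum : IsMinWindow n 0
  minimum = (3 ^ n , windowSum-middle n n (<⇒≤ (n<3^n n))) , λ _ → z≤n
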